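{- For every $n\ge1$, the set $\mathcal P_n$ of partial involutions on $n$ letters is in bijection with the set $\mathcal E_n$ of skew-symmetric $(n,n)$-clans whose base clan is $\underbrace{ -\cdots- }_{n}\underbrace{+\cdots+}_{n}$.
   Context: An $(n,n)$-clan is a string $\gamma=c_1\cdots c_{2n}$ of symbols from $\mathbb{N}\cup\{+,-\}$ such that each natural number appearing appears exactly twice and the numbers of $+$'s and $-$'s are equal; clans are equal if they have the same $\pm$ symbols in the same positions and the same sets of positions of matching pairs. $\gamma$ is skew-symmetric if $\gamma=-rev(\gamma)$, where $rev$ reverses the string and $-$ interchanges $+$ and $-$. The base clan of $\gamma$ is obtained by replacing, for each matching pair $c_i=c_j\in\mathbb N$ with $i<j$, the symbol $c_i$ by $-$ and $c_j$ by $+$. A partial permutation on $n$ letters is represented by an $n\times n$ $0/1$ matrix with at most one $1$ in each row and each column; a partial involution on $n$ letters is one whose matrix is symmetric. -}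

module Defs where

open import Data.Nat using (ℕ; zero; suc; _+_; _≤_)
open import Data.Bool using (Bool; true; false)
open import Data.Fin using (Fin; toℕ; opposite; _<_)
open import Data.Fin.Properties using (_<?_)
open import Data.Vec using (Vec; []; _∷_; lookup; tabulate; replicate; _++_)
open import Data.Product using (Σ; _×_; ∃-syntax; proj₁)
open import Relation.Binary.PropositionalEquality using (_≡_; _≢_)
open import Relation.Nullary using (yes; no)

-- A symbol of a clan of length m, in canonical form: a natural-number
-- symbol is recorded by the position of its matching partner, so that
-- two strings are equal as clans iff their encodings are equal
-- (same ± at same positions, same sets of matched position pairs).
data Sym (m : ℕ) : Set where
  plus  : Sym m
  minus : Sym m
  pair  : Fin m → Sym m

#plus : ∀ {m k} → Vec (Sym m) k → ℕ
#plus []             = 0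
#plus (plus   ∷ xs)  = suc (#plus xs)
#plus (minus  ∷ xs)  = #plus xs
#plus (pair _ ∷ xs)  = #plus xs

#minus : ∀ {m k} → Vec (Sym m) k → ℕ
#minus []             = 0
#minus (plus   ∷ xs)  = #minus xs
#minus (minus  ∷ xs)  = suc (#minus xs)
#minus (pair _ ∷ xs)  = #minus xs

-- An (n,n)-clan: a string of length 2n (= n + n) where each matched
-- position has a partner different from itself which points back
-- (so each number occurs exactly twice), and #(+) = #(-).
IsClan : (n : ℕ) → Vec (Sym (n + n)) (n + n) → Set
IsClan n γ =
  (∀ i j → lookup γ i ≡ pair j → (j ≢ i) × (lookup γ j ≡ pair i))
  × (#plus γ ≡ #minus γ)

negRev : ∀ {m} → Sym m → Sym m
negRev plus     = minus
negRev minus    = plus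
negRev (pair j) = pair (opposite j)

rev : ∀ {m} → Vec (Sym m) m → Vec (Sym m) m
rev γ = tabulate (λ i → lookup γ (opposite i))

negRevClan : ∀ {m} → Vec (Sym m) m → Vec (Sym m) m
negRevClan γ = tabulate (λ i → negRev (lookup γ (opposite i)))

IsSkewSymmetric : ∀ {m} → Vec (Sym m) m → Set
IsSkewSymmetric γ = γ ≡ negRevClan γ

baseSym : ∀ {m} → Fin m → Sym m → Sym m
baseSym i plus = plus
baseSym i minus = minus
baseSym i (pair j) with i <? j
... | yes _ = minus
... | no  _ = plus

baseClan : ∀ {m} → Vec (Sym m) m → Vec (Sym m) m
baseClan γ = tabulate (λ i → baseSym i (lookup γ i))

minusesPluses : (n : ℕ) → Vec (Sym (n + n)) (n + n)
minusesPluses n = replicate n minus ++ replicate n plus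

IsInE : (n : ℕ) → Vec (Sym (n + n)) (n + n) → Set
IsInE n γ = IsClan n γ × IsSkewSymmetric γ × (baseClan γ ≡ minusesPluses n)

E : ℕ → Set
E n = Σ (Vec (Sym (n + n)) (n + n)) (IsInE n)

Matrix : ℕ → Set
Matrix n = Vec (Vec Bool n) n

entry : ∀ {n} → Matrix n → Fin n → Fin n → Bool
entry M i j = lookup (lookup M i) j

IsPartialPermutation : ∀ {n} → Matrix n → Set
IsPartialPermutation M =
  (∀ i j k → entry M i j ≡ true → entry M i k ≡ true → j ≡ k)
  × (∀ i j k → entry M i k ≡ true → entry M j k ≡ true → i ≡ j)

IsPartialInvolution : ∀ {n} → Matrix n → Set
IsPartialInvolution M = IsPartialPermutation M × (∀ i j → entry M i j ≡ entry M j i)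

P : ℕ → Set
P n = Σ (Matrix n) IsPartialInvolution

-- Bijection between two subsets (Σ-types of a carrier with a property),
-- where elements are identified by their underlying carrier value
-- (the property-proof components are not compared): mutually inverse maps.
SubsetBijection : ∀ {A B : Set} (p : A → Set) (q : B → Set) → Set
SubsetBijection {A} {B} p q =
  Σ (Σ A p → Σ B q) λ f → Σ (Σ B q → Σ A p) λ g →
    (∀ x → proj₁ (g (f x)) ≡ proj₁ x) × (∀ y → proj₁ (f (g y)) ≡ proj₁ y)

-- By skew-symmetry a clan in 𝓔ₙ is determined by its first half. The base
-- clan -ⁿ+ⁿ forces every symbol of the first half to be - or a number whose
-- other occurrence lies in the second half, at the mirror image 2n+1-y of
-- some position y ≤ n. Reading such a symbol at position x as a 1 in row x
-- and column y (and - as an empty row) turns the first half into the rows of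
-- a partial permutation matrix, and skew-symmetry of the clan corresponds to
-- symmetry of the matrix.
module Submission where

open import Defs
open import Data.Nat using (ℕ; suc; _+_; _∸_; _≤_)
import Data.Nat.Properties as ℕ
open import Data.Bool using (Bool; true; false)
open import Data.Bool.Properties as Bool using (⇔→≡)
open import Data.Fin using (Fin; toℕ; opposite; _<_; _↑ˡ_; _↑ʳ_; splitAt)
open import Data.Fin.Properties
  using (_<?_; _≟_; any?; toℕ-↑ˡ; toℕ-↑ʳ; ↑ˡ-injective; splitAt⁻¹-↑ˡ; splitAt⁻¹-↑ʳ;
         opposite-prop; opposite-involutive; toℕ-injective; toℕ<n; <-asym; <⇒≢)
import Data.Fin.Permutation as Perm
open import Data.Vec using (Vec; []; _∷_; lookup; tabulate; replicate; _++_)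
open import Data.Vec.Properties
  using (lookup∘tabulate; tabulate∘lookup; tabulate-cong; lookup-++ˡ; lookup-++ʳ; lookup-replicate)
open import Algebra.Properties.CommutativeMonoid.Sum ℕ.+-0-commutativeMonoid
  using (sum-syntax; sum-cong-≗; ∑-permute)
open import Data.Product using (_×_; ∃-syntax; proj₁; proj₂; _,_)
open import Data.Sum using (inj₁; inj₂)
open import Function using (_∘_; mk⇔)
open import Relation.Binary.PropositionalEquality
open import Relation.Nullary using (yes; no; ¬_; does; contradiction)

lookup-ext : ∀ {A : Set} {k} {xs ys : Vec A k} → (∀ i → lookup xs i ≡ lookup ys i) → xs ≡ ys
lookup-ext {xs = xs} {ys} eq = trans (sym (tabulate∘lookup xs)) (trans (tabulate-cong eq) (tabulate∘lookup ys))

opposite-injective : ∀ {m} {i j : Fin m} → opposite i ≡ opposite j → i ≡ j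
opposite-injective {i = i} {j} eq =
  trans (sym (opposite-involutive i)) (trans (cong opposite eq) (opposite-involutive j))

data SplitView (m n : ℕ) : Fin (m + n) → Set where
  inLeft  : (i : Fin m) → SplitView m n (i ↑ˡ n)
  inRight : (j : Fin n) → SplitView m n (m ↑ʳ j)

splitView : ∀ m {n} (k : Fin (m + n)) → SplitView m n k
splitView m k with splitAt m k in eq
... | inj₁ i = subst (SplitView m _) (splitAt⁻¹-↑ˡ eq) (inLeft i)
... | inj₂ j = subst (SplitView m _) (splitAt⁻¹-↑ʳ eq) (inRight j)

↑ˡ<↑ʳ : ∀ {m n} (i : Fin m) (j : Fin n) → i ↑ˡ n < m ↑ʳ j
↑ˡ<↑ʳ {m} {n} i j = subst₂ Data.Nat._<_ (sym (toℕ-↑ˡ i n)) (sym (toℕ-↑ʳ m j))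
  (ℕ.<-≤-trans (toℕ<n i) (ℕ.m≤m+n m (toℕ j)))

opposite-↑ˡ : ∀ {n} (i : Fin n) → opposite (i ↑ˡ n) ≡ n ↑ʳ opposite i
opposite-↑ˡ {n} i = toℕ-injective (begin
  toℕ (opposite (i ↑ˡ n))     ≡⟨ opposite-prop (i ↑ˡ n) ⟩
  n + n ∸ suc (toℕ (i ↑ˡ n))  ≡⟨ cong (λ t → n + n ∸ suc t) (toℕ-↑ˡ i n) ⟩
  n + n ∸ suc (toℕ i)         ≡⟨ ℕ.+-∸-assoc n (toℕ<n i) ⟩
  n + (n ∸ suc (toℕ i))       ≡⟨ cong (n +_) (opposite-prop i) ⟨
  n + toℕ (opposite i)        ≡⟨ toℕ-↑ʳ n (opposite i) ⟨
  toℕ (n ↑ʳ opposite i)       ∎)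
  where open ≡-Reasoning

pair-injective : ∀ {m} {i j : Fin m} → pair i ≡ pair j → i ≡ j
pair-injective refl = refl

negRev-involutive : ∀ {m} (s : Sym m) → negRev (negRev s) ≡ s
negRev-involutive plus     = refl
negRev-involutive minus    = refl
negRev-involutive (pair j) = cong pair (opposite-involutive j)

plusIndicator minusIndicator : ∀ {m} → Sym m → ℕ
plusIndicator plus     = 1
plusIndicator minus    = 0
plusIndicator (pair _) = 0
minusIndicator s = plusIndicator (negRev s)

#plus≡∑ : ∀ {m k} (γ : Vec (Sym m) k) → #plus γ ≡ ∑[ i < k ] plusIndicator (lookup γ i)
#plus≡∑ []           = refl
#plus≡∑ (plus ∷ γ)   = cong suc (#plus≡∑ γ)
#plus≡∑ (minus ∷ γ)  = #plus≡∑ γ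
#plus≡∑ (pair _ ∷ γ) = #plus≡∑ γ

#minus≡∑ : ∀ {m k} (γ : Vec (Sym m) k) → #minus γ ≡ ∑[ i < k ] minusIndicator (lookup γ i)
#minus≡∑ []           = refl
#minus≡∑ (plus ∷ γ)   = #minus≡∑ γ
#minus≡∑ (minus ∷ γ)  = cong suc (#minus≡∑ γ)
#minus≡∑ (pair _ ∷ γ) = #minus≡∑ γ

WellMatchedAt : ∀ {m} → Vec (Sym m) m → Fin m → Set
WellMatchedAt γ i = ∀ j → lookup γ i ≡ pair j → (j ≢ i) × (lookup γ j ≡ pair i)

module _ {m : ℕ} {γ : Vec (Sym m) m} where

  skew⇒lookup-opposite : IsSkewSymmetric γ → ∀ i → lookup γ (opposite i) ≡ negRev (lookup γ i)
  skew⇒lookup-opposite skew i = begin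
    lookup γ (opposite i)                      ≡⟨ cong (λ δ → lookup δ (opposite i)) skew ⟩
    lookup (negRevClan γ) (opposite i)         ≡⟨ lookup∘tabulate _ (opposite i) ⟩
    negRev (lookup γ (opposite (opposite i)))  ≡⟨ cong (negRev ∘ lookup γ) (opposite-involutive i) ⟩
    negRev (lookup γ i)                        ∎
    where open ≡-Reasoning

  skew⇒pair-opposite : IsSkewSymmetric γ → ∀ {i j} → lookup γ i ≡ pair j →
                       lookup γ (opposite i) ≡ pair (opposite j)
  skew⇒pair-opposite skew {i} eq = trans (skew⇒lookup-opposite skew i) (cong negRev eq)

  lookup-opposite⇒skew : (∀ i → lookup γ (opposite i) ≡ negRev (lookup γ i)) → IsSkewSymmetric γ
  lookup-opposite⇒skew h = lookup-ext λ i → begin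
    lookup γ i                      ≡⟨ negRev-involutive (lookup γ i) ⟨
    negRev (negRev (lookup γ i))    ≡⟨ cong negRev (h i) ⟨
    negRev (lookup γ (opposite i))  ≡⟨ lookup∘tabulate _ i ⟨
    lookup (negRevClan γ) i         ∎
    where open ≡-Reasoning

  skew⇒#plus≡#minus : IsSkewSymmetric γ → #plus γ ≡ #minus γ
  skew⇒#plus≡#minus skew = begin
    #plus γ                                           ≡⟨ #plus≡∑ γ ⟩
    ∑[ i < m ] plusIndicator (lookup γ i)             ≡⟨ ∑-permute (plusIndicator ∘ lookup γ) Perm.reverse ⟩
    ∑[ i < m ] plusIndicator (lookup γ (opposite i))  ≡⟨ sum-cong-≗ indicator-opposite ⟩
    ∑[ i < m ] minusIndicator (lookup γ i)            ≡⟨ #minus≡∑ γ ⟨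
    #minus γ                                          ∎
    where
      open ≡-Reasoning
      indicator-opposite : ∀ i → plusIndicator (lookup γ (opposite i)) ≡ minusIndicator (lookup γ i)
      indicator-opposite i = cong plusIndicator (skew⇒lookup-opposite skew i)

  skew⇒wellMatched-opposite : IsSkewSymmetric γ → ∀ {i} → WellMatchedAt γ i → WellMatchedAt γ (opposite i)
  skew⇒wellMatched-opposite skew {i} matched j eq = j≢opposite-i , γj≡pair
    where
      γi≡pair : lookup γ i ≡ pair (opposite j)
      γi≡pair = subst (λ k → lookup γ k ≡ pair (opposite j)) (opposite-involutive i)
                      (skew⇒pair-opposite skew eq)
      j≢opposite-i : j ≢ opposite i
      j≢opposite-i j≡ = proj₁ (matched _ γi≡pair) (trans (cong opposite j≡) (opposite-involutive i))
      γj≡pair : lookup γ j ≡ pair (opposite i)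
      γj≡pair = subst (λ k → lookup γ k ≡ pair (opposite i)) (opposite-involutive j)
                      (skew⇒pair-opposite skew (proj₂ (matched _ γi≡pair)))

<⇒baseSym≡minus : ∀ {m} {i j : Fin m} → i < j → baseSym i (pair j) ≡ minus
<⇒baseSym≡minus {i = i} {j} i<j with i <? j
... | yes _   = refl
... | no i≮j = contradiction i<j i≮j

≮⇒baseSym≡plus : ∀ {m} {i j : Fin m} → ¬ (i < j) → baseSym i (pair j) ≡ plus
≮⇒baseSym≡plus {i = i} {j} i≮j with i <? j
... | yes i<j = contradiction i<j i≮j
... | no _    = refl

baseSym≡minus⇒< : ∀ {m} {i j : Fin m} → baseSym i (pair j) ≡ minus → i < j
baseSym≡minus⇒< {i = i} {j} eq with i <? j
... | yes i<j = i<j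

isPairWith : ∀ {m} → Sym m → Fin m → Bool
isPairWith plus     k = false
isPairWith minus    k = false
isPairWith (pair j) k = does (j ≟ k)

isPairWith≡true⇒ : ∀ {m} {s : Sym m} {k} → isPairWith s k ≡ true → s ≡ pair k
isPairWith≡true⇒ {s = pair j} {k} eq with j ≟ k
... | yes refl = refl

isPairWith-pair : ∀ {m} (k : Fin m) → isPairWith (pair k) k ≡ true
isPairWith-pair k with k ≟ k
... | yes _  = refl
... | no k≢k = contradiction refl k≢k

module Encoding (n : ℕ) where

  Clan : Set
  Clan = Vec (Sym (n + n)) (n + n)

  left right : Fin n → Fin (n + n)
  left x  = x ↑ˡ n
  right z = n ↑ʳ z

  opposite-left-opposite : ∀ z → opposite (left (opposite z)) ≡ right z
  opposite-left-opposite z = trans (opposite-↑ˡ (opposite z)) (cong right (opposite-involutive z))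

  opposite-right : ∀ z → opposite (right z) ≡ left (opposite z)
  opposite-right z = trans (cong opposite (sym (opposite-left-opposite z))) (opposite-involutive _)

  lookup-minusesPluses-left : ∀ x → lookup (minusesPluses n) (left x) ≡ minus
  lookup-minusesPluses-left x = trans (lookup-++ˡ (replicate n minus) _ x) (lookup-replicate x minus)

  lookup-minusesPluses-right : ∀ z → lookup (minusesPluses n) (right z) ≡ plus
  lookup-minusesPluses-right z = trans (lookup-++ʳ (replicate n minus) _ z) (lookup-replicate z plus)

  data RowCode : Sym (n + n) → Set where
    minus  : RowCode minus
    mirror : ∀ y → RowCode (pair (opposite (left y)))

  rowCode⇒baseSym-left : ∀ {s} x → RowCode s → baseSym (left x) s ≡ minus
  rowCode⇒baseSym-left x minus      = refl
  rowCode⇒baseSym-left x (mirror y) =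
    <⇒baseSym≡minus (subst (left x <_) (sym (opposite-↑ˡ y)) (↑ˡ<↑ʳ x (opposite y)))

  rowCode⇒baseSym-right : ∀ {s} z → RowCode s → baseSym (right z) (negRev s) ≡ plus
  rowCode⇒baseSym-right z minus      = refl
  rowCode⇒baseSym-right z (mirror y) rewrite opposite-involutive (left y) =
    ≮⇒baseSym≡plus (<-asym (↑ˡ<↑ʳ y z))

  complete : (Fin n → Sym (n + n)) → Clan
  complete ℓ = tabulate ℓ ++ tabulate (λ z → negRev (ℓ (opposite z)))

  lookup-complete-left : ∀ ℓ x → lookup (complete ℓ) (left x) ≡ ℓ x
  lookup-complete-left ℓ x = trans (lookup-++ˡ (tabulate ℓ) _ x) (lookup∘tabulate ℓ x)

  lookup-complete-right : ∀ ℓ z → lookup (complete ℓ) (right z) ≡ negRev (ℓ (opposite z))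
  lookup-complete-right ℓ z = trans (lookup-++ʳ (tabulate ℓ) _ z) (lookup∘tabulate _ z)

  complete-cong : ∀ {ℓ ℓ′} → (∀ x → ℓ x ≡ ℓ′ x) → complete ℓ ≡ complete ℓ′
  complete-cong eq = cong₂ _++_ (tabulate-cong eq) (tabulate-cong (cong negRev ∘ eq ∘ opposite))

  complete-skew : ∀ ℓ → IsSkewSymmetric (complete ℓ)
  complete-skew ℓ = lookup-opposite⇒skew skewAt
    where
      skewAt : ∀ i → lookup (complete ℓ) (opposite i) ≡ negRev (lookup (complete ℓ) i)
      skewAt i with splitView n i
      ... | inLeft x = begin
        lookup (complete ℓ) (opposite (left x))   ≡⟨ cong (lookup (complete ℓ)) (opposite-↑ˡ x) ⟩
        lookup (complete ℓ) (right (opposite x))  ≡⟨ lookup-complete-right ℓ (opposite x) ⟩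
        negRev (ℓ (opposite (opposite x)))        ≡⟨ cong (negRev ∘ ℓ) (opposite-involutive x) ⟩
        negRev (ℓ x)                              ≡⟨ cong negRev (lookup-complete-left ℓ x) ⟨
        negRev (lookup (complete ℓ) (left x))     ∎
        where open ≡-Reasoning
      ... | inRight z = begin
        lookup (complete ℓ) (opposite (right z))  ≡⟨ cong (lookup (complete ℓ)) (opposite-right z) ⟩
        lookup (complete ℓ) (left (opposite z))   ≡⟨ lookup-complete-left ℓ (opposite z) ⟩
        ℓ (opposite z)                            ≡⟨ negRev-involutive _ ⟨
        negRev (negRev (ℓ (opposite z)))          ≡⟨ cong negRev (lookup-complete-right ℓ z) ⟨
        negRev (lookup (complete ℓ) (right z))    ∎
        where open ≡-Reasoning

  skew⇒complete-left : ∀ {γ} → IsSkewSymmetric γ → complete (lookup γ ∘ left) ≡ γ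
  skew⇒complete-left {γ} skew = lookup-ext agree
    where
      agree : ∀ i → lookup (complete (lookup γ ∘ left)) i ≡ lookup γ i
      agree i with splitView n i
      ... | inLeft x  = lookup-complete-left _ x
      ... | inRight z = begin
        lookup (complete (lookup γ ∘ left)) (right z)  ≡⟨ lookup-complete-right _ z ⟩
        negRev (lookup γ (left (opposite z)))          ≡⟨ cong (negRev ∘ lookup γ) (opposite-right z) ⟨
        negRev (lookup γ (opposite (right z)))         ≡⟨ cong negRev (skew⇒lookup-opposite skew (right z)) ⟩
        negRev (negRev (lookup γ (right z)))           ≡⟨ negRev-involutive _ ⟩
        lookup γ (right z)                             ∎
        where open ≡-Reasoning

  complete-base : ∀ {ℓ} → (∀ x → RowCode (ℓ x)) → baseClan (complete ℓ) ≡ minusesPluses n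
  complete-base {ℓ} code = lookup-ext baseAt
    where
      baseAt : ∀ i → lookup (baseClan (complete ℓ)) i ≡ lookup (minusesPluses n) i
      baseAt i rewrite lookup∘tabulate (λ k → baseSym k (lookup (complete ℓ) k)) i with splitView n i
      ... | inLeft x rewrite lookup-complete-left ℓ x | lookup-minusesPluses-left x =
        rowCode⇒baseSym-left x (code x)
      ... | inRight z rewrite lookup-complete-right ℓ z | lookup-minusesPluses-right z =
        rowCode⇒baseSym-right z (code (opposite z))

  wellMatched-left⇒wellMatched : ∀ {γ} → IsSkewSymmetric γ → (∀ x → WellMatchedAt γ (left x)) →
                                 ∀ i → WellMatchedAt γ i
  wellMatched-left⇒wellMatched {γ} skew matched i with splitView n i
  ... | inLeft x  = matched x
  ... | inRight z = subst (WellMatchedAt γ) (opposite-left-opposite z)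
                      (skew⇒wellMatched-opposite skew (matched (opposite z)))

  rowSym : Matrix n → Fin n → Sym (n + n)
  rowSym M x with any? (λ y → entry M x y Bool.≟ true)
  ... | yes (y , _) = pair (opposite (left y))
  ... | no _        = minus

  rowSym-rowCode : ∀ M x → RowCode (rowSym M x)
  rowSym-rowCode M x with any? (λ y → entry M x y Bool.≟ true)
  ... | yes (y , _) = mirror y
  ... | no _        = minus

  rowSym≡pair⇒ : ∀ M x {j} → rowSym M x ≡ pair j → ∃[ y ] entry M x y ≡ true × j ≡ opposite (left y)
  rowSym≡pair⇒ M x eq with any? (λ y → entry M x y Bool.≟ true)
  rowSym≡pair⇒ M x refl | yes (y , Mxy) = y , Mxy , refl

  entry⇒rowSym : ∀ {M} → IsPartialPermutation M → ∀ {x y} → entry M x y ≡ true →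
                 rowSym M x ≡ pair (opposite (left y))
  entry⇒rowSym {M} (rowUnique , _) {x} {y} Mxy with any? (λ y → entry M x y Bool.≟ true)
  ... | yes (y′ , Mxy′) = cong (pair ∘ opposite ∘ left) (rowUnique x y′ y Mxy′ Mxy)
  ... | no noEntry      = contradiction (y , Mxy) noEntry

  noEntry⇒rowSym≡minus : ∀ {M x} → (∀ y → entry M x y ≢ true) → rowSym M x ≡ minus
  noEntry⇒rowSym≡minus {M} {x} noEntry with any? (λ y → entry M x y Bool.≟ true)
  ... | yes (y , Mxy) = contradiction Mxy (noEntry y)
  ... | no _          = refl

  encode : Matrix n → Clan
  encode M = complete (rowSym M)

  module _ {M : Matrix n} (involution : IsPartialInvolution M) where

    encode-wellMatched-left : ∀ x → WellMatchedAt (encode M) (left x)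
    encode-wellMatched-left x j eq with rowSym≡pair⇒ M x (trans (sym (lookup-complete-left _ x)) eq)
    ... | y , Mxy , refl = opposite-left≢left , encode-at-mirror
      where
        opposite-left≢left : opposite (left y) ≢ left x
        opposite-left≢left eq′ = <⇒≢ (↑ˡ<↑ʳ x (opposite y)) (trans (sym eq′) (opposite-↑ˡ y))
        Myx : entry M y x ≡ true
        Myx = trans (proj₂ involution y x) Mxy
        encode-at-mirror : lookup (encode M) (opposite (left y)) ≡ pair (left x)
        encode-at-mirror =
          subst (λ k → lookup (encode M) (opposite (left y)) ≡ pair k) (opposite-involutive (left x))
          (skew⇒pair-opposite (complete-skew _)
            (trans (lookup-complete-left _ y) (entry⇒rowSym (proj₁ involution) Myx)))

    encode-∈𝓔 : IsInE n (encode M)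
    encode-∈𝓔 =
      (wellMatched-left⇒wellMatched skew encode-wellMatched-left , skew⇒#plus≡#minus skew) ,
      skew , complete-base (rowSym-rowCode M)
      where skew = complete-skew (rowSym M)

  decode : Clan → Matrix n
  decode γ = tabulate λ x → tabulate λ y → isPairWith (lookup γ (left x)) (opposite (left y))

  entry-decode : ∀ γ x y → entry (decode γ) x y ≡ isPairWith (lookup γ (left x)) (opposite (left y))
  entry-decode γ x y = trans (cong (λ row → lookup row y) (lookup∘tabulate _ x)) (lookup∘tabulate _ y)

  entry-decode≡true⇒ : ∀ {γ x y} → entry (decode γ) x y ≡ true → lookup γ (left x) ≡ pair (opposite (left y))
  entry-decode≡true⇒ {γ} {x} {y} eq = isPairWith≡true⇒ (trans (sym (entry-decode γ x y)) eq)

  ⇒entry-decode≡true : ∀ {γ x y} → lookup γ (left x) ≡ pair (opposite (left y)) → entry (decode γ) x y ≡ true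
  ⇒entry-decode≡true {γ} {x} {y} eq =
    trans (entry-decode γ x y) (trans (cong (λ s → isPairWith s _) eq) (isPairWith-pair (opposite (left y))))

  mirror-injective : ∀ {y y′} → pair (opposite (left y)) ≡ pair (opposite (left y′)) → y ≡ y′
  mirror-injective eq = ↑ˡ-injective n _ _ (opposite-injective (pair-injective eq))

  isPairWith-rowSym : ∀ {M} → IsPartialPermutation M → ∀ x y →
                      isPairWith (rowSym M x) (opposite (left y)) ≡ entry M x y
  isPairWith-rowSym {M} permutation x y = ⇔→≡ {z = true} (mk⇔ to from)
    where
      to : isPairWith (rowSym M x) (opposite (left y)) ≡ true → entry M x y ≡ true
      to eq with rowSym≡pair⇒ M x (isPairWith≡true⇒ eq)
      ... | y′ , Mxy′ , mirror-y≡mirror-y′ = subst (λ k → entry M x k ≡ true)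
                                                   (sym (mirror-injective (cong pair mirror-y≡mirror-y′))) Mxy′
      from : entry M x y ≡ true → isPairWith (rowSym M x) (opposite (left y)) ≡ true
      from Mxy = trans (cong (λ s → isPairWith s _) (entry⇒rowSym permutation Mxy))
                       (isPairWith-pair (opposite (left y)))

  decode-encode : ∀ {M} → IsPartialPermutation M → decode (encode M) ≡ M
  decode-encode {M} permutation = lookup-ext λ x → lookup-ext λ y → begin
    entry (decode (encode M)) x y                                ≡⟨ entry-decode (encode M) x y ⟩
    isPairWith (lookup (encode M) (left x)) (opposite (left y))  ≡⟨ cong (λ s → isPairWith s _) (lookup-complete-left _ x) ⟩
    isPairWith (rowSym M x) (opposite (left y))                  ≡⟨ isPairWith-rowSym permutation x y ⟩
    entry M x y                                                  ∎
    where open ≡-Reasoning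

  module _ {γ : Clan} (γ∈𝓔 : IsInE n γ) where

    private
      matched = proj₁ (proj₁ γ∈𝓔)
      skew    = proj₁ (proj₂ γ∈𝓔)
      base    = proj₂ (proj₂ γ∈𝓔)

    baseSym-left : ∀ x → baseSym (left x) (lookup γ (left x)) ≡ minus
    baseSym-left x = begin
      baseSym (left x) (lookup γ (left x))  ≡⟨ lookup∘tabulate _ (left x) ⟨
      lookup (baseClan γ) (left x)          ≡⟨ cong (λ δ → lookup δ (left x)) base ⟩
      lookup (minusesPluses n) (left x)     ≡⟨ lookup-minusesPluses-left x ⟩
      minus                                 ∎
      where open ≡-Reasoning

    ∈𝓔⇒rowCode : ∀ x → RowCode (lookup γ (left x))
    ∈𝓔⇒rowCode x with lookup γ (left x) in eq | baseSym-left x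
    ... | minus  | _ = minus
    ... | pair j | x-base with splitView n j
    ...   | inRight z = subst RowCode (cong pair (opposite-left-opposite z)) (mirror (opposite z))
    ...   | inLeft w = contradiction (baseSym≡minus⇒< x-base) (<-asym (baseSym≡minus⇒< w-base))
      where
        w-base : baseSym (left w) (pair (left x)) ≡ minus
        w-base = subst (λ s → baseSym (left w) s ≡ minus) (proj₂ (matched _ _ eq)) (baseSym-left w)

    partner-of-entry : ∀ {x y} → entry (decode γ) x y ≡ true → lookup γ (opposite (left y)) ≡ pair (left x)
    partner-of-entry Mxy = proj₂ (matched _ _ (entry-decode≡true⇒ {γ} Mxy))

    decode-transpose : ∀ {x y} → entry (decode γ) x y ≡ true → entry (decode γ) y x ≡ true
    decode-transpose {x} {y} Mxy = ⇒entry-decode≡true {γ}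
      (subst (λ k → lookup γ k ≡ pair (opposite (left x))) (opposite-involutive (left y))
             (skew⇒pair-opposite skew (partner-of-entry Mxy)))

    decode-partialInvolution : IsPartialInvolution (decode γ)
    decode-partialInvolution = (rowUnique , columnUnique) , symmetric
      where
        rowUnique : ∀ x y y′ → entry (decode γ) x y ≡ true → entry (decode γ) x y′ ≡ true → y ≡ y′
        rowUnique x y y′ Mxy Mxy′ =
          mirror-injective (trans (sym (entry-decode≡true⇒ {γ} Mxy)) (entry-decode≡true⇒ {γ} Mxy′))
        columnUnique : ∀ x x′ y → entry (decode γ) x y ≡ true → entry (decode γ) x′ y ≡ true → x ≡ x′
        columnUnique x x′ y Mxy Mx′y =
          ↑ˡ-injective n x x′ (pair-injective (trans (sym (partner-of-entry Mxy)) (partner-of-entry Mx′y)))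
        symmetric : ∀ x y → entry (decode γ) x y ≡ entry (decode γ) y x
        symmetric x y = ⇔→≡ {z = true} (mk⇔ decode-transpose decode-transpose)

    rowSym-decode : ∀ x → rowSym (decode γ) x ≡ lookup γ (left x)
    rowSym-decode x with lookup γ (left x) in eq | ∈𝓔⇒rowCode x
    ... | _ | minus    =
      noEntry⇒rowSym≡minus λ y Mxy → minus≢pair (trans (sym eq) (entry-decode≡true⇒ {γ} Mxy))
      where
        minus≢pair : ∀ {j} → minus ≢ pair j
        minus≢pair ()
    ... | _ | mirror y = entry⇒rowSym (proj₁ decode-partialInvolution) (⇒entry-decode≡true {γ} eq)

    encode-decode : encode (decode γ) ≡ γ
    encode-decode = trans (complete-cong rowSym-decode) (skew⇒complete-left skew)

-- The bijection also exists for n = 0.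
theorem6p4 : (n : ℕ) → 1 ≤ n → SubsetBijection (IsPartialInvolution {n}) (IsInE n)
theorem6p4 n _ =
  (λ (M , involution) → encode M , encode-∈𝓔 involution) ,
  (λ (γ , γ∈𝓔) → decode γ , decode-partialInvolution γ∈𝓔) ,
  (λ (M , involution) → decode-encode (proj₁ involution)) ,
  (λ (γ , γ∈𝓔) → encode-decode γ∈𝓔)
  where open Encoding n
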